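{- Let $\mathbb T$ be a CSC-theory with syntactic category $S(\mathbb T)$, and let $(\mathcal T,\eta,\mu,\tau)$ and $(\mathcal S,\eta^{\mathcal S},\mu^{\mathcal S},\tau^{\mathcal S})$ be the strong monads on $S(\mathbb T)$ given by $\mathcal X[A]=[\mathcal XA]$, $\mathcal X[x:A\vdash f:B]=[y:\mathcal XA\vdash\mathtt{do}_{\mathcal X}x\leftarrow y;\mathtt{ret}_{\mathcal X}f:\mathcal XB]$, $\eta^{\mathcal X}_{[A]}=[x:A\vdash\mathtt{ret}_{\mathcal X}x:\mathcal XA]$, $\mu^{\mathcal X}_{[A]}=[x:\mathcal X\mathcal XA\vdash\mathtt{do}_{\mathcal X}y\leftarrow x;y:\mathcal XA]$, $\tau^{\mathcal X}_{[A],[B]}=[x:A\times\mathcal XB\vdash\mathtt{do}_{\mathcal X}y\leftarrow\pi_2x;\mathtt{ret}_{\mathcal X}\langle\pi_1x,y\rangle:\mathcal X(A\times B)]$ for $\mathcal X\in\{\mathcal S,\mathcal T\}$. Then the assignment $\iota_{[A]}=[x:\mathcal SA\vdash\iota x:\mathcal TA]$ is independent of the choice of representative and defines a strong submonad monomorphism $\iota:\mathcal S\Rightarrow\mathcal T$ which makes $\mathcal S$ a central submonad of $\mathcal T$.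
   Context: CSC (Central Submonad Calculus): types $A,B::=G\mid 1\mid A\to B\mid A\times B\mid\mathcal SA\mid\mathcal TA$; terms $x\mid *\mid\lambda x^A.M\mid MN\mid\langle M,N\rangle\mid\pi_iM\mid\mathtt{ret}_{\mathcal S}M\mid\mathtt{ret}_{\mathcal T}M\mid\iota M\mid\mathtt{do}_{\mathcal S}x\leftarrow M;N\mid\mathtt{do}_{\mathcal T}x\leftarrow M;N$, typed by the usual simply-typed rules plus (for $\mathcal X\in\{\mathcal S,\mathcal T\}$) $\mathtt{ret}_{\mathcal X}:A\Rightarrow\mathcal XA$, $\iota:\mathcal SA\Rightarrow\mathcal TA$, and $\Gamma\vdash M:\mathcal XA$, $\Gamma,x:A\vdash N:\mathcal XB$ give $\Gamma\vdash\mathtt{do}_{\mathcal X}x\leftarrow M;N:\mathcal XB$; judgements closed under weakening. Type equality is a congruent equivalence relation respected by typing. Term equality is a congruent equivalence relation closed under substitution and weakening containing the $\beta\eta$ laws for $1$, $\times$, $\to$; for each $\mathcal X$ the monad laws $\mathtt{do}_{\mathcal X}x\leftarrow\mathtt{ret}_{\mathcal X}M;N=N[M/x]$, $\mathtt{do}_{\mathcal X}x\leftarrow M;\mathtt{ret}_{\mathcal X}x=M$, $\mathtt{do}_{\mathcal X}y\leftarrow(\mathtt{do}_{\mathcal X}x\leftarrow M;N);P=\mathtt{do}_{\mathcal X}x\leftarrow M;\mathtt{do}_{\mathcal X}y\leftarrow N;P$ ($\Gamma\vdash M:\mathcal XA$, $\Gamma\vdash N:\mathcal XB$, $\Gamma,x:A,y:B\vdash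 P:\mathcal XC$); centrality $\mathtt{do}_{\mathcal T}x\leftarrow\iota M;\mathtt{do}_{\mathcal T}y\leftarrow N;P=\mathtt{do}_{\mathcal T}y\leftarrow N;\mathtt{do}_{\mathcal T}x\leftarrow\iota M;P$ ($M:\mathcal SA$, $N:\mathcal TB$, $\Gamma,x:A,y:B\vdash P:\mathcal TC$); $\iota M=\iota N$ iff $M=N$; $\mathtt{do}_{\mathcal T}x\leftarrow\iota M;\iota N=\iota(\mathtt{do}_{\mathcal S}x\leftarrow M;N)$; $\iota(\mathtt{ret}_{\mathcal S}M)=\mathtt{ret}_{\mathcal T}M$. A CSC-theory extends CSC with ground types, term constants (well-formed in any context) and equality axioms. $S(\mathbb T)$: objects are types modulo provable type equality; morphisms $[A]\to[B]$ are judgements $x:A\vdash f:B$ modulo provable equality (and type equality); composition is substitution; it is cartesian closed. Central submonad: a strong submonad $\iota:\mathcal S\Rightarrow\mathcal T$ (monic morphism of strong monads: $\iota\circ\eta^{\mathcal S}=\eta$, $\iota\circ\mu^{\mathcal S}=\mu\circ\mathcal T\iota\circ\iota_{\mathcal S}$, $\iota\circ\tau^{\mathcal S}=\tau\circ(A\times\iota)$) such that each $(\mathcal SX,\iota_X)$ is a central cone, i.e. for all $Y$, $\mu\circ\mathcal T\tau'\circ\tau\circ(\iota_X\times\mathrm{id}_{\mathcal TY})=\mu\circ\mathcal T\tau\circ\tau'\circ(\iota_X\times\mathrm{id}_{\mathcal TY})$ as maps $\mathcal SX\times\mathcal TY\to\mathcal T(X\times Y)$, where $\tau'$ is the right strength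 obtained from $\tau$ by conjugating with the symmetry. -}

module Defs where

open import Data.Nat using (ℕ; zero; suc)
open import Data.Fin using (Fin; zero; suc; inject₁)
open import Data.Vec using (Vec; []; _∷_; lookup)

data Mon : Set where
  𝒮 𝒯 : Mon

data Ty (G : Set) : Set where
  ground : G → Ty G
  one    : Ty G
  _⇒_    : Ty G → Ty G → Ty G
  _⊗_    : Ty G → Ty G → Ty G
  𝕄      : Mon → Ty G → Ty G

infixr 5 _⇒_
infixr 6 _⊗_

module Terms (G C : Set) where

  data Tm (n : ℕ) : Set where
    var   : Fin n → Tm n
    const : C → Tm n
    unit  : Tm n
    lam   : Ty G → Tm (suc n) → Tm n
    app   : Tm n → Tm n → Tm n
    pair  : Tm n → Tm n → Tm n
    fst   : Tm n → Tm n
    snd   : Tm n → Tm n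
    ret   : Mon → Tm n → Tm n
    iota  : Tm n → Tm n
    bind  : Mon → Tm n → Tm (suc n) → Tm n -- do_𝒳 x ← M ; N   (x = var zero in N)

  Ren : ℕ → ℕ → Set
  Ren n m = Fin n → Fin m

  ext : ∀ {n m} → Ren n m → Ren (suc n) (suc m)
  ext ρ zero    = zero
  ext ρ (suc i) = suc (ρ i)

  rename : ∀ {n m} → Ren n m → Tm n → Tm m
  rename ρ (var i)      = var (ρ i)
  rename ρ (const c)    = const c
  rename ρ unit         = unit
  rename ρ (lam A M)    = lam A (rename (ext ρ) M)
  rename ρ (app M N)    = app (rename ρ M) (rename ρ N)
  rename ρ (pair M N)   = pair (rename ρ M) (rename ρ N)
  rename ρ (fst M)      = fst (rename ρ M)
  rename ρ (snd M)      = snd (rename ρ M)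
  rename ρ (ret X M)    = ret X (rename ρ M)
  rename ρ (iota M)     = iota (rename ρ M)
  rename ρ (bind X M N) = bind X (rename ρ M) (rename (ext ρ) N)

  wk : ∀ {n} → Tm n → Tm (suc n)
  wk = rename suc

  Sub : ℕ → ℕ → Set
  Sub n m = Fin n → Tm m

  exts : ∀ {n m} → Sub n m → Sub (suc n) (suc m)
  exts σ zero    = var zero
  exts σ (suc i) = wk (σ i)

  sub : ∀ {n m} → Sub n m → Tm n → Tm m
  sub σ (var i)      = σ i
  sub σ (const c)    = const c
  sub σ unit         = unit
  sub σ (lam A M)    = lam A (sub (exts σ) M)
  sub σ (app M N)    = app (sub σ M) (sub σ N)
  sub σ (pair M N)   = pair (sub σ M) (sub σ N)
  sub σ (fst M)      = fst (sub σ M)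
  sub σ (snd M)      = snd (sub σ M)
  sub σ (ret X M)    = ret X (sub σ M)
  sub σ (iota M)     = iota (sub σ M)
  sub σ (bind X M N) = bind X (sub σ M) (sub (exts σ) N)

  sub0 : ∀ {n} → Tm n → Sub (suc n) n
  sub0 N zero    = N
  sub0 N (suc i) = var i

  _[_]₀ : ∀ {n} → Tm (suc n) → Tm n → Tm n
  M [ N ]₀ = sub (sub0 N) M

  swap01 : ∀ {n} → Ren (suc (suc n)) (suc (suc n))
  swap01 zero          = suc zero
  swap01 (suc zero)    = zero
  swap01 (suc (suc i)) = suc (suc i)

record Theory : Set₁ where
  field
    Ground  : Set
    Const   : Set
    constTy : Const → Ty Ground
    TyAx    : Set
    tyAxL   : TyAx → Ty Ground
    tyAxR   : TyAx → Ty Ground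
    TmAx    : Set
    tmAxLen : TmAx → ℕ
    tmAxCtx : (a : TmAx) → Vec (Ty Ground) (tmAxLen a)
    tmAxTy  : TmAx → Ty Ground
    tmAxL   : (a : TmAx) → Terms.Tm Ground Const (tmAxLen a)
    tmAxR   : (a : TmAx) → Terms.Tm Ground Const (tmAxLen a)

module CSC (𝕋 : Theory) where
  open Theory 𝕋
  open Terms Ground Const public

  Type : Set
  Type = Ty Ground

  Ctx : ℕ → Set
  Ctx n = Vec Type n

  infix 4 _≅_
  data _≅_ : Type → Type → Set where
    ≅-ax    : (a : TyAx) → tyAxL a ≅ tyAxR a
    ≅-refl  : ∀ {A} → A ≅ A
    ≅-sym   : ∀ {A B} → A ≅ B → B ≅ A
    ≅-trans : ∀ {A B C} → A ≅ B → B ≅ C → A ≅ C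
    ≅-⇒     : ∀ {A A' B B'} → A ≅ A' → B ≅ B' → (A ⇒ B) ≅ (A' ⇒ B')
    ≅-⊗     : ∀ {A A' B B'} → A ≅ A' → B ≅ B' → (A ⊗ B) ≅ (A' ⊗ B')
    ≅-𝕄     : ∀ {A A'} X → A ≅ A' → 𝕄 X A ≅ 𝕄 X A'

  _≅ᶜ_ : ∀ {n} → Ctx n → Ctx n → Set
  Γ ≅ᶜ Δ = ∀ i → lookup Γ i ≅ lookup Δ i

  infix 3 _⊢_∶_
  data _⊢_∶_ : ∀ {n} → Ctx n → Tm n → Type → Set where
    ⊢var   : ∀ {n} {Γ : Ctx n} i → Γ ⊢ var i ∶ lookup Γ i
    ⊢const : ∀ {n} {Γ : Ctx n} c → Γ ⊢ const c ∶ constTy c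
    ⊢unit  : ∀ {n} {Γ : Ctx n} → Γ ⊢ unit ∶ one
    ⊢lam   : ∀ {n} {Γ : Ctx n} {A B M} → (A ∷ Γ) ⊢ M ∶ B → Γ ⊢ lam A M ∶ A ⇒ B
    ⊢app   : ∀ {n} {Γ : Ctx n} {A B M N} → Γ ⊢ M ∶ A ⇒ B → Γ ⊢ N ∶ A → Γ ⊢ app M N ∶ B
    ⊢pair  : ∀ {n} {Γ : Ctx n} {A B M N} → Γ ⊢ M ∶ A → Γ ⊢ N ∶ B → Γ ⊢ pair M N ∶ A ⊗ B
    ⊢fst   : ∀ {n} {Γ : Ctx n} {A B M} → Γ ⊢ M ∶ A ⊗ B → Γ ⊢ fst M ∶ A
    ⊢snd   : ∀ {n} {Γ : Ctx n} {A B M} → Γ ⊢ M ∶ A ⊗ B → Γ ⊢ snd M ∶ B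
    ⊢ret   : ∀ {n} {Γ : Ctx n} {A M} X → Γ ⊢ M ∶ A → Γ ⊢ ret X M ∶ 𝕄 X A
    ⊢iota  : ∀ {n} {Γ : Ctx n} {A M} → Γ ⊢ M ∶ 𝕄 𝒮 A → Γ ⊢ iota M ∶ 𝕄 𝒯 A
    ⊢bind  : ∀ {n} {Γ : Ctx n} {A B M N} X →
             Γ ⊢ M ∶ 𝕄 X A → (A ∷ Γ) ⊢ N ∶ 𝕄 X B → Γ ⊢ bind X M N ∶ 𝕄 X B
    ⊢conv  : ∀ {n} {Γ Δ : Ctx n} {A B M} → Γ ≅ᶜ Δ → A ≅ B → Γ ⊢ M ∶ A → Δ ⊢ M ∶ B
    ⊢wk    : ∀ {n} {Γ : Ctx n} {A B M} → Γ ⊢ M ∶ A → (B ∷ Γ) ⊢ wk M ∶ A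

  infix 3 _⊢_≈_∶_
  data _⊢_≈_∶_ : ∀ {n} → Ctx n → Tm n → Tm n → Type → Set where
    ≈-refl  : ∀ {n} {Γ : Ctx n} {A M} → Γ ⊢ M ∶ A → Γ ⊢ M ≈ M ∶ A
    ≈-sym   : ∀ {n} {Γ : Ctx n} {A M N} → Γ ⊢ M ≈ N ∶ A → Γ ⊢ N ≈ M ∶ A
    ≈-trans : ∀ {n} {Γ : Ctx n} {A M N P} → Γ ⊢ M ≈ N ∶ A → Γ ⊢ N ≈ P ∶ A → Γ ⊢ M ≈ P ∶ A
    ≈-ax    : (a : TmAx) → tmAxCtx a ⊢ tmAxL a ≈ tmAxR a ∶ tmAxTy a
    ≈-conv  : ∀ {n} {Γ Δ : Ctx n} {A B M N} → Γ ≅ᶜ Δ → A ≅ B → Γ ⊢ M ≈ N ∶ A → Δ ⊢ M ≈ N ∶ B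
    ≈-sub   : ∀ {n m} {Γ : Ctx n} {Δ : Ctx m} {A M N} (σ : Sub n m) →
              (∀ i → Δ ⊢ σ i ∶ lookup Γ i) → Γ ⊢ M ≈ N ∶ A → Δ ⊢ sub σ M ≈ sub σ N ∶ A
    ≈-lam   : ∀ {n} {Γ : Ctx n} {A A' B M M'} → A ≅ A' → (A ∷ Γ) ⊢ M ≈ M' ∶ B →
              Γ ⊢ lam A M ≈ lam A' M' ∶ A ⇒ B
    ≈-app   : ∀ {n} {Γ : Ctx n} {A B M M' N N'} → Γ ⊢ M ≈ M' ∶ A ⇒ B → Γ ⊢ N ≈ N' ∶ A →
              Γ ⊢ app M N ≈ app M' N' ∶ B
    ≈-pair  : ∀ {n} {Γ : Ctx n} {A B M M' N N'} → Γ ⊢ M ≈ M' ∶ A → Γ ⊢ N ≈ N' ∶ B →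
              Γ ⊢ pair M N ≈ pair M' N' ∶ A ⊗ B
    ≈-fst   : ∀ {n} {Γ : Ctx n} {A B M M'} → Γ ⊢ M ≈ M' ∶ A ⊗ B → Γ ⊢ fst M ≈ fst M' ∶ A
    ≈-snd   : ∀ {n} {Γ : Ctx n} {A B M M'} → Γ ⊢ M ≈ M' ∶ A ⊗ B → Γ ⊢ snd M ≈ snd M' ∶ B
    ≈-ret   : ∀ {n} {Γ : Ctx n} {A M M'} X → Γ ⊢ M ≈ M' ∶ A → Γ ⊢ ret X M ≈ ret X M' ∶ 𝕄 X A
    ≈-iota  : ∀ {n} {Γ : Ctx n} {A M M'} → Γ ⊢ M ≈ M' ∶ 𝕄 𝒮 A → Γ ⊢ iota M ≈ iota M' ∶ 𝕄 𝒯 A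
    ≈-bind  : ∀ {n} {Γ : Ctx n} {A B M M' N N'} X → Γ ⊢ M ≈ M' ∶ 𝕄 X A →
              (A ∷ Γ) ⊢ N ≈ N' ∶ 𝕄 X B → Γ ⊢ bind X M N ≈ bind X M' N' ∶ 𝕄 X B
    η-one   : ∀ {n} {Γ : Ctx n} {M} → Γ ⊢ M ∶ one → Γ ⊢ M ≈ unit ∶ one
    β-fst   : ∀ {n} {Γ : Ctx n} {A B M N} → Γ ⊢ M ∶ A → Γ ⊢ N ∶ B → Γ ⊢ fst (pair M N) ≈ M ∶ A
    β-snd   : ∀ {n} {Γ : Ctx n} {A B M N} → Γ ⊢ M ∶ A → Γ ⊢ N ∶ B → Γ ⊢ snd (pair M N) ≈ N ∶ B
    η-pair  : ∀ {n} {Γ : Ctx n} {A B M} → Γ ⊢ M ∶ A ⊗ B → Γ ⊢ pair (fst M) (snd M) ≈ M ∶ A ⊗ B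
    β-lam   : ∀ {n} {Γ : Ctx n} {A B M N} → (A ∷ Γ) ⊢ M ∶ B → Γ ⊢ N ∶ A →
              Γ ⊢ app (lam A M) N ≈ M [ N ]₀ ∶ B
    η-lam   : ∀ {n} {Γ : Ctx n} {A B M} → Γ ⊢ M ∶ A ⇒ B →
              Γ ⊢ lam A (app (wk M) (var zero)) ≈ M ∶ A ⇒ B
    m-unitˡ : ∀ {n} {Γ : Ctx n} {A B M N} X → Γ ⊢ M ∶ A → (A ∷ Γ) ⊢ N ∶ 𝕄 X B →
              Γ ⊢ bind X (ret X M) N ≈ N [ M ]₀ ∶ 𝕄 X B
    m-unitʳ : ∀ {n} {Γ : Ctx n} {A M} X → Γ ⊢ M ∶ 𝕄 X A →
              Γ ⊢ bind X M (ret X (var zero)) ≈ M ∶ 𝕄 X A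
    m-assoc : ∀ {n} {Γ : Ctx n} {A B C M N P} X → Γ ⊢ M ∶ 𝕄 X A →
              (A ∷ Γ) ⊢ N ∶ 𝕄 X B → (B ∷ Γ) ⊢ P ∶ 𝕄 X C →
              Γ ⊢ bind X (bind X M N) P ≈ bind X M (bind X N (rename (ext suc) P)) ∶ 𝕄 X C
    -- centrality:  do x ← ι M; do y ← N; P  =  do y ← N; do x ← ι M; P
    -- (P in context Γ, x : A, y : B)
    central : ∀ {n} {Γ : Ctx n} {A B C M N P} → Γ ⊢ M ∶ 𝕄 𝒮 A → Γ ⊢ N ∶ 𝕄 𝒯 B →
              (B ∷ A ∷ Γ) ⊢ P ∶ 𝕄 𝒯 C →
              Γ ⊢ bind 𝒯 (iota M) (bind 𝒯 (wk N) P)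
                ≈ bind 𝒯 N (bind 𝒯 (wk (iota M)) (rename swap01 P)) ∶ 𝕄 𝒯 C
    iota-inj  : ∀ {n} {Γ : Ctx n} {A M N} → Γ ⊢ iota M ≈ iota N ∶ 𝕄 𝒯 A → Γ ⊢ M ≈ N ∶ 𝕄 𝒮 A
    iota-bind : ∀ {n} {Γ : Ctx n} {A B M N} → Γ ⊢ M ∶ 𝕄 𝒮 A → (A ∷ Γ) ⊢ N ∶ 𝕄 𝒮 B →
                Γ ⊢ bind 𝒯 (iota M) (iota N) ≈ iota (bind 𝒮 M N) ∶ 𝕄 𝒯 B
    iota-ret  : ∀ {n} {Γ : Ctx n} {A M} → Γ ⊢ M ∶ A → Γ ⊢ iota (ret 𝒮 M) ≈ ret 𝒯 M ∶ 𝕄 𝒯 A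

  -- Objects: types (modulo _≅_).  A morphism [A] → [B] is represented by a
  -- term f : Tm 1 with  x : A ⊢ f : B  (x = var zero); two representatives
  -- are equal when their types are ≅ and the terms are provably equal.

  Hom : Type → Type → Tm 1 → Set
  Hom A B f = (A ∷ []) ⊢ f ∶ B

  -- equality of morphisms in S(𝕋), possibly given by different representatives
  -- of their domain and codomain
  HomEq : (A B : Type) → Tm 1 → (A' B' : Type) → Tm 1 → Set
  HomEq A B f A' B' f' = (A ≅ A') × (B ≅ B') × ((A ∷ []) ⊢ f ≈ f' ∶ B)
    where open import Data.Product using (_×_)

  infixr 9 _∘ₘ_
  _∘ₘ_ : Tm 1 → Tm 1 → Tm 1
  g ∘ₘ f = sub (at f) g
    where
      at : Tm 1 → Sub 1 1
      at t zero = t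

  idₘ π₁ₘ π₂ₘ swapₘ : Tm 1
  idₘ   = var zero
  π₁ₘ   = fst (var zero)
  π₂ₘ   = snd (var zero)
  swapₘ = pair (snd (var zero)) (fst (var zero))

  _×ₘ_ : Tm 1 → Tm 1 → Tm 1
  f ×ₘ g = pair (f ∘ₘ π₁ₘ) (g ∘ₘ π₂ₘ)

  fmap : Mon → Tm 1 → Tm 1
  fmap X f = bind X (var zero) (ret X (rename inject₁ f))

  η : Mon → Tm 1
  η X = ret X (var zero)

  μ : Mon → Tm 1
  μ X = bind X (var zero) (var zero)

  τ : Mon → Tm 1
  τ X = bind X (snd (var zero)) (ret X (pair (fst (var (suc zero))) (var zero)))

  τ' : Mon → Tm 1
  τ' X = fmap X swapₘ ∘ₘ (τ X ∘ₘ swapₘ)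

  ιₘ : Tm 1
  ιₘ = iota (var zero)

  record IsCentralSubmonad : Set where
    field
      ι-hom      : ∀ A → Hom (𝕄 𝒮 A) (𝕄 𝒯 A) ιₘ
      ι-welldef  : ∀ {A A'} → A ≅ A' →
                   HomEq (𝕄 𝒮 A) (𝕄 𝒯 A) ιₘ (𝕄 𝒮 A') (𝕄 𝒯 A') ιₘ
      ι-natural  : ∀ {A B f} → Hom A B f →
                   (𝕄 𝒮 A ∷ []) ⊢ fmap 𝒯 f ∘ₘ ιₘ ≈ ιₘ ∘ₘ fmap 𝒮 f ∶ 𝕄 𝒯 B
      ι-mono     : ∀ {A C g h} → Hom C (𝕄 𝒮 A) g → Hom C (𝕄 𝒮 A) h →
                   (C ∷ []) ⊢ ιₘ ∘ₘ g ≈ ιₘ ∘ₘ h ∶ 𝕄 𝒯 A →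
                   (C ∷ []) ⊢ g ≈ h ∶ 𝕄 𝒮 A
      ι-unit     : ∀ A → (A ∷ []) ⊢ ιₘ ∘ₘ η 𝒮 ≈ η 𝒯 ∶ 𝕄 𝒯 A
      ι-mult     : ∀ A → (𝕄 𝒮 (𝕄 𝒮 A) ∷ []) ⊢ ιₘ ∘ₘ μ 𝒮
                                            ≈ μ 𝒯 ∘ₘ (fmap 𝒯 ιₘ ∘ₘ ιₘ) ∶ 𝕄 𝒯 A
      ι-strength : ∀ A B → ((A ⊗ 𝕄 𝒮 B) ∷ []) ⊢ ιₘ ∘ₘ τ 𝒮
                                             ≈ τ 𝒯 ∘ₘ (idₘ ×ₘ ιₘ) ∶ 𝕄 𝒯 (A ⊗ B)
      -- (𝒮X, ι_X) is a central cone, for every Y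
      ι-central  : ∀ X Y → ((𝕄 𝒮 X ⊗ 𝕄 𝒯 Y) ∷ []) ⊢
                     μ 𝒯 ∘ₘ (fmap 𝒯 (τ' 𝒯) ∘ₘ (τ 𝒯 ∘ₘ (ιₘ ×ₘ idₘ)))
                   ≈ μ 𝒯 ∘ₘ (fmap 𝒯 (τ 𝒯) ∘ₘ (τ' 𝒯 ∘ₘ (ιₘ ×ₘ idₘ))) ∶ 𝕄 𝒯 (X ⊗ Y)

module Submission where

-- Every component of ι is the term ι x, so well-definedness, monicity and the
-- unit law are the CSC rules for ι themselves, while naturality and the
-- multiplication and strength laws reduce, by βη and the monad laws, to
-- do x ← ι M; ι N = ι (do x ← M; N).  For the central cone, both composites
-- normalise to do-blocks that run ι (π₁ p) and π₂ p in opposite orders, and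
-- the centrality axiom of CSC identifies them.

open import Defs
open import Data.Bool using (T)
open import Data.Fin using (zero; suc; inject₁)
open import Data.Maybe using (Maybe; just; nothing; is-just; to-witness-T)
open import Data.Nat using (suc)
open import Data.Product using (_,_; proj₁; proj₂; ∃-syntax)
open import Data.Vec using ([]; _∷_; lookup)
open import Relation.Binary.Bundles using (PartialSetoid)
open import Relation.Binary.PropositionalEquality
  using (_≡_; refl; cong; cong₂; sym; trans; subst)
import Relation.Binary.Reasoning.PartialSetoid as PartialSetoidReasoning

module TermProperties (G C : Set) where
  open Terms G C

  ext-cong : ∀ {n m} {ρ ρ' : Ren n m} → (∀ i → ρ i ≡ ρ' i) → ∀ i → ext ρ i ≡ ext ρ' i
  ext-cong ρ≗ρ' zero    = refl
  ext-cong ρ≗ρ' (suc i) = cong suc (ρ≗ρ' i)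

  rename-cong : ∀ {n m} {ρ ρ' : Ren n m} → (∀ i → ρ i ≡ ρ' i) → ∀ M → rename ρ M ≡ rename ρ' M
  rename-cong ρ≗ρ' (var i)      = cong var (ρ≗ρ' i)
  rename-cong ρ≗ρ' (const c)    = refl
  rename-cong ρ≗ρ' unit         = refl
  rename-cong ρ≗ρ' (lam A M)    = cong (lam A) (rename-cong (ext-cong ρ≗ρ') M)
  rename-cong ρ≗ρ' (app M N)    = cong₂ app (rename-cong ρ≗ρ' M) (rename-cong ρ≗ρ' N)
  rename-cong ρ≗ρ' (pair M N)   = cong₂ pair (rename-cong ρ≗ρ' M) (rename-cong ρ≗ρ' N)
  rename-cong ρ≗ρ' (fst M)      = cong fst (rename-cong ρ≗ρ' M)
  rename-cong ρ≗ρ' (snd M)      = cong snd (rename-cong ρ≗ρ' M)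
  rename-cong ρ≗ρ' (ret X M)    = cong (ret X) (rename-cong ρ≗ρ' M)
  rename-cong ρ≗ρ' (iota M)     = cong iota (rename-cong ρ≗ρ' M)
  rename-cong ρ≗ρ' (bind X M N) =
    cong₂ (bind X) (rename-cong ρ≗ρ' M) (rename-cong (ext-cong ρ≗ρ') N)

  ext-∘ : ∀ {n m k} (ρ : Ren m k) (ρ' : Ren n m) i → ext ρ (ext ρ' i) ≡ ext (λ j → ρ (ρ' j)) i
  ext-∘ ρ ρ' zero    = refl
  ext-∘ ρ ρ' (suc i) = refl

  rename-∘ : ∀ {n m k} (ρ : Ren m k) (ρ' : Ren n m) M →
             rename ρ (rename ρ' M) ≡ rename (λ i → ρ (ρ' i)) M
  rename-∘ ρ ρ' (var i)      = refl
  rename-∘ ρ ρ' (const c)    = refl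
  rename-∘ ρ ρ' unit         = refl
  rename-∘ ρ ρ' (lam A M)    =
    cong (lam A) (trans (rename-∘ (ext ρ) (ext ρ') M) (rename-cong (ext-∘ ρ ρ') M))
  rename-∘ ρ ρ' (app M N)    = cong₂ app (rename-∘ ρ ρ' M) (rename-∘ ρ ρ' N)
  rename-∘ ρ ρ' (pair M N)   = cong₂ pair (rename-∘ ρ ρ' M) (rename-∘ ρ ρ' N)
  rename-∘ ρ ρ' (fst M)      = cong fst (rename-∘ ρ ρ' M)
  rename-∘ ρ ρ' (snd M)      = cong snd (rename-∘ ρ ρ' M)
  rename-∘ ρ ρ' (ret X M)    = cong (ret X) (rename-∘ ρ ρ' M)
  rename-∘ ρ ρ' (iota M)     = cong iota (rename-∘ ρ ρ' M)
  rename-∘ ρ ρ' (bind X M N) =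
    cong₂ (bind X) (rename-∘ ρ ρ' M)
                   (trans (rename-∘ (ext ρ) (ext ρ') N) (rename-cong (ext-∘ ρ ρ') N))

  exts-ext-var : ∀ {n m k} (σ : Sub m k) (ρ : Ren n m) (θ : Ren n k) →
                 (∀ i → σ (ρ i) ≡ var (θ i)) → ∀ i → exts σ (ext ρ i) ≡ var (ext θ i)
  exts-ext-var σ ρ θ σρ≗θ zero    = refl
  exts-ext-var σ ρ θ σρ≗θ (suc i) = cong wk (σρ≗θ i)

  sub-rename-var : ∀ {n m k} (σ : Sub m k) (ρ : Ren n m) (θ : Ren n k) →
                   (∀ i → σ (ρ i) ≡ var (θ i)) → ∀ M → sub σ (rename ρ M) ≡ rename θ M
  sub-rename-var σ ρ θ h (var i)      = h i
  sub-rename-var σ ρ θ h (const c)    = refl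
  sub-rename-var σ ρ θ h unit         = refl
  sub-rename-var σ ρ θ h (lam A M)    =
    cong (lam A) (sub-rename-var (exts σ) (ext ρ) (ext θ) (exts-ext-var σ ρ θ h) M)
  sub-rename-var σ ρ θ h (app M N)    = cong₂ app (sub-rename-var σ ρ θ h M) (sub-rename-var σ ρ θ h N)
  sub-rename-var σ ρ θ h (pair M N)   = cong₂ pair (sub-rename-var σ ρ θ h M) (sub-rename-var σ ρ θ h N)
  sub-rename-var σ ρ θ h (fst M)      = cong fst (sub-rename-var σ ρ θ h M)
  sub-rename-var σ ρ θ h (snd M)      = cong snd (sub-rename-var σ ρ θ h M)
  sub-rename-var σ ρ θ h (ret X M)    = cong (ret X) (sub-rename-var σ ρ θ h M)
  sub-rename-var σ ρ θ h (iota M)     = cong iota (sub-rename-var σ ρ θ h M)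
  sub-rename-var σ ρ θ h (bind X M N) =
    cong₂ (bind X) (sub-rename-var σ ρ θ h M)
                   (sub-rename-var (exts σ) (ext ρ) (ext θ) (exts-ext-var σ ρ θ h) N)

  sub-exts-inject₁ : ∀ (σ : Sub 1 1) f → sub (exts σ) (rename inject₁ f) ≡ rename inject₁ f
  sub-exts-inject₁ σ = sub-rename-var (exts σ) inject₁ inject₁ λ { zero → refl }

module CentralSubmonad (𝕋 : Theory) where
  open Theory 𝕋
  open CSC 𝕋
  open TermProperties Ground Const

  x₀ : ∀ {n} → Tm (suc n)
  x₀ = var zero

  x₁ : ∀ {n} → Tm (suc (suc n))
  x₁ = var (suc zero)

  x₂ : ∀ {n} → Tm (suc (suc (suc n)))
  x₂ = var (suc (suc zero))

  lookup-ext-≅ : ∀ {n m} {Γ : Ctx n} {Δ : Ctx m} {B} {ρ : Ren n m} →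
                 (∀ i → lookup Γ i ≅ lookup Δ (ρ i)) → ∀ i → lookup (B ∷ Γ) i ≅ lookup (B ∷ Δ) (ext ρ i)
  lookup-ext-≅ Γ≅Δρ zero    = ≅-refl
  lookup-ext-≅ Γ≅Δρ (suc i) = Γ≅Δρ i

  ⊢rename : ∀ {n m} {Γ : Ctx n} {Δ : Ctx m} {A M} (ρ : Ren n m) →
            (∀ i → lookup Γ i ≅ lookup Δ (ρ i)) → Γ ⊢ M ∶ A → Δ ⊢ rename ρ M ∶ A
  ⊢rename {Δ = Δ} ρ h (⊢var i) = ⊢conv {Γ = Δ} (λ _ → ≅-refl) (≅-sym (h i)) (⊢var (ρ i))
  ⊢rename ρ h (⊢const c)   = ⊢const c
  ⊢rename ρ h ⊢unit        = ⊢unit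
  ⊢rename ρ h (⊢lam d)     = ⊢lam (⊢rename (ext ρ) (lookup-ext-≅ h) d)
  ⊢rename ρ h (⊢app d e)   = ⊢app (⊢rename ρ h d) (⊢rename ρ h e)
  ⊢rename ρ h (⊢pair d e)  = ⊢pair (⊢rename ρ h d) (⊢rename ρ h e)
  ⊢rename ρ h (⊢fst d)     = ⊢fst (⊢rename ρ h d)
  ⊢rename ρ h (⊢snd d)     = ⊢snd (⊢rename ρ h d)
  ⊢rename ρ h (⊢ret X d)   = ⊢ret X (⊢rename ρ h d)
  ⊢rename ρ h (⊢iota d)    = ⊢iota (⊢rename ρ h d)
  ⊢rename ρ h (⊢bind X d e) = ⊢bind X (⊢rename ρ h d) (⊢rename (ext ρ) (lookup-ext-≅ h) e)
  ⊢rename {Δ = Δ} ρ h (⊢conv Γ≅Γ' A≅B d) =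
    ⊢conv {Γ = Δ} (λ _ → ≅-refl) A≅B (⊢rename ρ (λ i → ≅-trans (Γ≅Γ' i) (h i)) d)
  ⊢rename {Δ = Δ} {A = A} ρ h (⊢wk {M = M} d) =
    subst (λ t → Δ ⊢ t ∶ A) (sym (rename-∘ ρ suc M)) (⊢rename (λ i → ρ (suc i)) (λ i → h (suc i)) d)

  ⊢inject₁ : ∀ {A B C f} → Hom A B f → (A ∷ C ∷ []) ⊢ rename inject₁ f ∶ B
  ⊢inject₁ = ⊢rename inject₁ λ { zero → ≅-refl }

  Inferred : ∀ {n} → Ctx n → Tm n → Set
  Inferred Γ M = Maybe (∃[ A ] Γ ⊢ M ∶ A)

  infer-pair : ∀ {n} {Γ : Ctx n} {M N} → Inferred Γ M → Inferred Γ N → Inferred Γ (pair M N)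
  infer-pair (just (A , d)) (just (B , e)) = just (A ⊗ B , ⊢pair d e)
  infer-pair _              _              = nothing

  infer-fst : ∀ {n} {Γ : Ctx n} {M} → Inferred Γ M → Inferred Γ (fst M)
  infer-fst (just (A ⊗ B , d)) = just (A , ⊢fst d)
  infer-fst _                  = nothing

  infer-snd : ∀ {n} {Γ : Ctx n} {M} → Inferred Γ M → Inferred Γ (snd M)
  infer-snd (just (A ⊗ B , d)) = just (B , ⊢snd d)
  infer-snd _                  = nothing

  infer-lam : ∀ {n} {Γ : Ctx n} {M} A → Inferred (A ∷ Γ) M → Inferred Γ (lam A M)
  infer-lam A (just (B , d)) = just (A ⇒ B , ⊢lam d)
  infer-lam A nothing        = nothing

  infer-ret : ∀ {n} {Γ : Ctx n} {M} X → Inferred Γ M → Inferred Γ (ret X M)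
  infer-ret X (just (A , d)) = just (𝕄 X A , ⊢ret X d)
  infer-ret X nothing        = nothing

  infer-iota : ∀ {n} {Γ : Ctx n} {M} → Inferred Γ M → Inferred Γ (iota M)
  infer-iota (just (𝕄 𝒮 A , d)) = just (𝕄 𝒯 A , ⊢iota d)
  infer-iota _                  = nothing

  infer-body : ∀ {n} {Γ : Ctx n} {M N} X {A} →
               Γ ⊢ M ∶ 𝕄 X A → Inferred (A ∷ Γ) N → Inferred Γ (bind X M N)
  infer-body 𝒮 d (just (𝕄 𝒮 B , e)) = just (𝕄 𝒮 B , ⊢bind 𝒮 d e)
  infer-body 𝒯 d (just (𝕄 𝒯 B , e)) = just (𝕄 𝒯 B , ⊢bind 𝒯 d e)
  infer-body _ _ _                  = nothing

  infer-bind : ∀ {n} {Γ : Ctx n} {M N} X →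
               Inferred Γ M → (∀ A → Inferred (A ∷ Γ) N) → Inferred Γ (bind X M N)
  infer-bind 𝒮 (just (𝕄 𝒮 A , d)) infer-N = infer-body 𝒮 d (infer-N A)
  infer-bind 𝒯 (just (𝕄 𝒯 A , d)) infer-N = infer-body 𝒯 d (infer-N A)
  infer-bind _ _                  _       = nothing

  infer : ∀ {n} (Γ : Ctx n) M → Inferred Γ M
  infer Γ (var i)      = just (lookup Γ i , ⊢var i)
  infer Γ (const c)    = just (constTy c , ⊢const c)
  infer Γ unit         = just (one , ⊢unit)
  infer Γ (lam A M)    = infer-lam A (infer (A ∷ Γ) M)
  infer Γ (app M N)    = nothing
  infer Γ (pair M N)   = infer-pair (infer Γ M) (infer Γ N)
  infer Γ (fst M)      = infer-fst (infer Γ M)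
  infer Γ (snd M)      = infer-snd (infer Γ M)
  infer Γ (ret X M)    = infer-ret X (infer Γ M)
  infer Γ (iota M)     = infer-iota (infer Γ M)
  infer Γ (bind X M N) = infer-bind X (infer Γ M) (λ A → infer (A ∷ Γ) N)

  -- Once `infer` computes to `just` the implicit argument has type ⊤ and is
  -- filled in by η, so `⊢infer _` discharges routine typing side conditions.
  ⊢infer : ∀ {n} {Γ : Ctx n} M {ok : T (is-just (infer Γ M))} →
           Γ ⊢ M ∶ proj₁ (to-witness-T (infer Γ M) ok)
  ⊢infer {Γ = Γ} M {ok} = proj₂ (to-witness-T (infer Γ M) ok)

  ≈-reflᵢ : ∀ {n} {Γ : Ctx n} {M} {ok : T (is-just (infer Γ M))} →
            Γ ⊢ M ≈ M ∶ proj₁ (to-witness-T (infer Γ M) ok)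
  ≈-reflᵢ {M = M} {ok} = ≈-refl (⊢infer M {ok})

  β-fstᵢ : ∀ {n} {Γ : Ctx n} {M N} {okM : T (is-just (infer Γ M))} {okN : T (is-just (infer Γ N))} →
           Γ ⊢ fst (pair M N) ≈ M ∶ proj₁ (to-witness-T (infer Γ M) okM)
  β-fstᵢ {M = M} {N} {okM} {okN} = β-fst (⊢infer M {okM}) (⊢infer N {okN})

  β-sndᵢ : ∀ {n} {Γ : Ctx n} {M N} {okM : T (is-just (infer Γ M))} {okN : T (is-just (infer Γ N))} →
           Γ ⊢ snd (pair M N) ≈ N ∶ proj₁ (to-witness-T (infer Γ N) okN)
  β-sndᵢ {M = M} {N} {okM} {okN} = β-snd (⊢infer M {okM}) (⊢infer N {okN})

  ≈-partialSetoid : ∀ {n} → Ctx n → Type → PartialSetoid _ _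
  ≈-partialSetoid {n} Γ A = record
    { Carrier              = Tm n
    ; _≈_                  = λ M N → Γ ⊢ M ≈ N ∶ A
    ; isPartialEquivalence = record { sym = ≈-sym ; trans = ≈-trans }
    }

  module ≈-Reasoning {n} (Γ : Ctx n) (A : Type) = PartialSetoidReasoning (≈-partialSetoid Γ A)

  ∘ₘ-congˡ : ∀ {A B C f f' k} → Hom C A k →
             (A ∷ []) ⊢ f ≈ f' ∶ B → (C ∷ []) ⊢ f ∘ₘ k ≈ f' ∘ₘ k ∶ B
  ∘ₘ-congˡ ⊢k = ≈-sub _ λ { zero → ⊢k }

  fmap-∘ₘ : ∀ X g h → fmap X g ∘ₘ h ≡ bind X h (ret X (rename inject₁ g))
  fmap-∘ₘ X g h = cong (λ t → bind X h (ret X t)) (sub-exts-inject₁ _ g)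

  μ-∘-fmap : ∀ X {A B C} g h → Hom C (𝕄 X A) h → Hom A (𝕄 X B) g →
             (C ∷ []) ⊢ μ X ∘ₘ (fmap X g ∘ₘ h) ≈ bind X h (rename inject₁ g) ∶ 𝕄 X B
  μ-∘-fmap X {C = C} g h ⊢h ⊢g = begin
    μ X ∘ₘ (fmap X g ∘ₘ h)
      ≡⟨ cong (μ X ∘ₘ_) (fmap-∘ₘ X g h) ⟩
    bind X (bind X h (ret X (rename inject₁ g))) x₀
      ≈⟨ m-assoc X ⊢h (⊢ret X (⊢inject₁ ⊢g)) (⊢var zero) ⟩
    bind X h (bind X (ret X (rename inject₁ g)) x₀)
      ≈⟨ ≈-bind X (≈-refl ⊢h) (m-unitˡ X (⊢inject₁ ⊢g) (⊢var zero)) ⟩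
    bind X h (rename inject₁ g)
      ∎
    where open ≈-Reasoning (C ∷ []) _

  τ'-unfold : ∀ A B → ((𝕄 𝒯 A ⊗ B) ∷ []) ⊢
              τ' 𝒯 ≈ bind 𝒯 (fst x₀) (ret 𝒯 (pair x₀ (snd x₁))) ∶ 𝕄 𝒯 (A ⊗ B)
  τ'-unfold A B = begin
    bind 𝒯 (bind 𝒯 (snd (pair (snd x₀) (fst x₀))) (ret 𝒯 (pair (fst (pair (snd x₁) (fst x₁))) x₀)))
           (ret 𝒯 (pair (snd x₀) (fst x₀)))
      ≈⟨ ≈-bind 𝒯 (≈-bind 𝒯 β-sndᵢ (≈-ret 𝒯 (≈-pair β-fstᵢ ≈-reflᵢ))) ≈-reflᵢ ⟩
    bind 𝒯 (bind 𝒯 (fst x₀) (ret 𝒯 (pair (snd x₁) x₀))) (ret 𝒯 (pair (snd x₀) (fst x₀)))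
      ≈⟨ m-assoc 𝒯 (⊢infer _) (⊢infer _) (⊢infer _) ⟩
    bind 𝒯 (fst x₀) (bind 𝒯 (ret 𝒯 (pair (snd x₁) x₀)) (ret 𝒯 (pair (snd x₀) (fst x₀))))
      ≈⟨ ≈-bind 𝒯 ≈-reflᵢ (m-unitˡ 𝒯 (⊢infer _) (⊢infer _)) ⟩
    bind 𝒯 (fst x₀) (ret 𝒯 (pair (snd (pair (snd x₁) x₀)) (fst (pair (snd x₁) x₀))))
      ≈⟨ ≈-bind 𝒯 ≈-reflᵢ (≈-ret 𝒯 (≈-pair β-sndᵢ β-fstᵢ)) ⟩
    bind 𝒯 (fst x₀) (ret 𝒯 (pair x₀ (snd x₁)))
      ∎
    where open ≈-Reasoning ((𝕄 𝒯 A ⊗ B) ∷ []) (𝕄 𝒯 (A ⊗ B))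

  -- With named variables the two normal forms below read
  --   do y ← π₂ p; do a ← ι (π₁ p); ret ⟨ a , y ⟩   and
  --   do a ← ι (π₁ p); do y ← π₂ p; ret ⟨ a , y ⟩.
  central-cone-left : ∀ X Y → ((𝕄 𝒮 X ⊗ 𝕄 𝒯 Y) ∷ []) ⊢
                      μ 𝒯 ∘ₘ (fmap 𝒯 (τ' 𝒯) ∘ₘ (τ 𝒯 ∘ₘ (ιₘ ×ₘ idₘ)))
                    ≈ bind 𝒯 (snd x₀) (bind 𝒯 (iota (fst x₁)) (ret 𝒯 (pair x₀ x₁))) ∶ 𝕄 𝒯 (X ⊗ Y)
  central-cone-left X Y = begin
    μ 𝒯 ∘ₘ (fmap 𝒯 (τ' 𝒯) ∘ₘ (τ 𝒯 ∘ₘ (ιₘ ×ₘ idₘ)))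
      ≈⟨ μ-∘-fmap 𝒯 (τ' 𝒯) (τ 𝒯 ∘ₘ (ιₘ ×ₘ idₘ)) (⊢infer _) (⊢infer _) ⟩
    bind 𝒯 (τ 𝒯 ∘ₘ (ιₘ ×ₘ idₘ)) (rename inject₁ (τ' 𝒯))
      ≈⟨ ≈-bind 𝒯 (≈-bind 𝒯 β-sndᵢ (≈-ret 𝒯 (≈-pair β-fstᵢ ≈-reflᵢ)))
                  (≈-sub (λ { zero → x₀ }) (λ { zero → ⊢var zero }) (τ'-unfold X Y)) ⟩
    bind 𝒯 (bind 𝒯 (snd x₀) (ret 𝒯 (pair (iota (fst x₁)) x₀)))
           (bind 𝒯 (fst x₀) (ret 𝒯 (pair x₀ (snd x₁))))
      ≈⟨ m-assoc 𝒯 (⊢infer _) (⊢infer _) (⊢infer _) ⟩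
    bind 𝒯 (snd x₀) (bind 𝒯 (ret 𝒯 (pair (iota (fst x₁)) x₀))
                            (bind 𝒯 (fst x₀) (ret 𝒯 (pair x₀ (snd x₁)))))
      ≈⟨ ≈-bind 𝒯 ≈-reflᵢ (m-unitˡ 𝒯 (⊢infer _) (⊢infer _)) ⟩
    bind 𝒯 (snd x₀) (bind 𝒯 (fst (pair (iota (fst x₁)) x₀))
                            (ret 𝒯 (pair x₀ (snd (pair (iota (fst x₂)) x₁)))))
      ≈⟨ ≈-bind 𝒯 ≈-reflᵢ (≈-bind 𝒯 β-fstᵢ (≈-ret 𝒯 (≈-pair ≈-reflᵢ β-sndᵢ))) ⟩
    bind 𝒯 (snd x₀) (bind 𝒯 (iota (fst x₁)) (ret 𝒯 (pair x₀ x₁)))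
      ∎
    where open ≈-Reasoning ((𝕄 𝒮 X ⊗ 𝕄 𝒯 Y) ∷ []) (𝕄 𝒯 (X ⊗ Y))

  central-cone-right : ∀ X Y → ((𝕄 𝒮 X ⊗ 𝕄 𝒯 Y) ∷ []) ⊢
                       μ 𝒯 ∘ₘ (fmap 𝒯 (τ 𝒯) ∘ₘ (τ' 𝒯 ∘ₘ (ιₘ ×ₘ idₘ)))
                     ≈ bind 𝒯 (iota (fst x₀)) (bind 𝒯 (snd x₁) (ret 𝒯 (pair x₁ x₀))) ∶ 𝕄 𝒯 (X ⊗ Y)
  central-cone-right X Y = begin
    μ 𝒯 ∘ₘ (fmap 𝒯 (τ 𝒯) ∘ₘ (τ' 𝒯 ∘ₘ (ιₘ ×ₘ idₘ)))
      ≈⟨ μ-∘-fmap 𝒯 (τ 𝒯) (τ' 𝒯 ∘ₘ (ιₘ ×ₘ idₘ)) (⊢infer _) (⊢infer _) ⟩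
    bind 𝒯 (τ' 𝒯 ∘ₘ (ιₘ ×ₘ idₘ)) (rename inject₁ (τ 𝒯))
      ≈⟨ ≈-bind 𝒯 (∘ₘ-congˡ (⊢infer _) (τ'-unfold X (𝕄 𝒯 Y))) ≈-reflᵢ ⟩
    bind 𝒯 (bind 𝒯 (fst (pair (iota (fst x₀)) (snd x₀)))
                   (ret 𝒯 (pair x₀ (snd (pair (iota (fst x₁)) (snd x₁))))))
           (bind 𝒯 (snd x₀) (ret 𝒯 (pair (fst x₁) x₀)))
      ≈⟨ ≈-bind 𝒯 (≈-bind 𝒯 β-fstᵢ (≈-ret 𝒯 (≈-pair ≈-reflᵢ β-sndᵢ))) ≈-reflᵢ ⟩
    bind 𝒯 (bind 𝒯 (iota (fst x₀)) (ret 𝒯 (pair x₀ (snd x₁))))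
           (bind 𝒯 (snd x₀) (ret 𝒯 (pair (fst x₁) x₀)))
      ≈⟨ m-assoc 𝒯 (⊢infer _) (⊢infer _) (⊢infer _) ⟩
    bind 𝒯 (iota (fst x₀)) (bind 𝒯 (ret 𝒯 (pair x₀ (snd x₁)))
                                   (bind 𝒯 (snd x₀) (ret 𝒯 (pair (fst x₁) x₀))))
      ≈⟨ ≈-bind 𝒯 ≈-reflᵢ (m-unitˡ 𝒯 (⊢infer _) (⊢infer _)) ⟩
    bind 𝒯 (iota (fst x₀)) (bind 𝒯 (snd (pair x₀ (snd x₁)))
                                   (ret 𝒯 (pair (fst (pair x₁ (snd x₂))) x₀)))
      ≈⟨ ≈-bind 𝒯 ≈-reflᵢ (≈-bind 𝒯 β-sndᵢ (≈-ret 𝒯 (≈-pair β-fstᵢ ≈-reflᵢ))) ⟩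
    bind 𝒯 (iota (fst x₀)) (bind 𝒯 (snd x₁) (ret 𝒯 (pair x₁ x₀)))
      ∎
    where open ≈-Reasoning ((𝕄 𝒮 X ⊗ 𝕄 𝒯 Y) ∷ []) (𝕄 𝒯 (X ⊗ Y))

  ι-natural : ∀ {A B f} → Hom A B f → (𝕄 𝒮 A ∷ []) ⊢ fmap 𝒯 f ∘ₘ ιₘ ≈ ιₘ ∘ₘ fmap 𝒮 f ∶ 𝕄 𝒯 B
  ι-natural {A} {B} {f} ⊢f = begin
    fmap 𝒯 f ∘ₘ ιₘ
      ≡⟨ fmap-∘ₘ 𝒯 f ιₘ ⟩
    bind 𝒯 (iota x₀) (ret 𝒯 (rename inject₁ f))
      ≈⟨ ≈-bind 𝒯 (≈-refl (⊢iota (⊢var zero))) (iota-ret ⊢f₁) ⟨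
    bind 𝒯 (iota x₀) (iota (ret 𝒮 (rename inject₁ f)))
      ≈⟨ iota-bind (⊢var zero) (⊢ret 𝒮 ⊢f₁) ⟩
    iota (bind 𝒮 x₀ (ret 𝒮 (rename inject₁ f)))
      ∎
    where
      open ≈-Reasoning (𝕄 𝒮 A ∷ []) (𝕄 𝒯 B)
      ⊢f₁ : (A ∷ 𝕄 𝒮 A ∷ []) ⊢ rename inject₁ f ∶ B
      ⊢f₁ = ⊢inject₁ ⊢f

  ι-mult : ∀ A → (𝕄 𝒮 (𝕄 𝒮 A) ∷ []) ⊢ ιₘ ∘ₘ μ 𝒮 ≈ μ 𝒯 ∘ₘ (fmap 𝒯 ιₘ ∘ₘ ιₘ) ∶ 𝕄 𝒯 A
  ι-mult A = begin
    iota (bind 𝒮 x₀ x₀)              ≈⟨ iota-bind (⊢infer _) (⊢infer _) ⟨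
    bind 𝒯 (iota x₀) (iota x₀)       ≈⟨ μ-∘-fmap 𝒯 ιₘ ιₘ (⊢infer _) (⊢infer _) ⟨
    μ 𝒯 ∘ₘ (fmap 𝒯 ιₘ ∘ₘ ιₘ)        ∎
    where open ≈-Reasoning (𝕄 𝒮 (𝕄 𝒮 A) ∷ []) (𝕄 𝒯 A)

  ι-strength : ∀ A B → ((A ⊗ 𝕄 𝒮 B) ∷ []) ⊢ ιₘ ∘ₘ τ 𝒮 ≈ τ 𝒯 ∘ₘ (idₘ ×ₘ ιₘ) ∶ 𝕄 𝒯 (A ⊗ B)
  ι-strength A B = begin
    iota (bind 𝒮 (snd x₀) (ret 𝒮 (pair (fst x₁) x₀)))
      ≈⟨ iota-bind (⊢infer _) (⊢infer _) ⟨
    bind 𝒯 (iota (snd x₀)) (iota (ret 𝒮 (pair (fst x₁) x₀)))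
      ≈⟨ ≈-bind 𝒯 ≈-reflᵢ (iota-ret (⊢infer _)) ⟩
    bind 𝒯 (iota (snd x₀)) (ret 𝒯 (pair (fst x₁) x₀))
      ≈⟨ ≈-bind 𝒯 β-sndᵢ (≈-ret 𝒯 (≈-pair β-fstᵢ ≈-reflᵢ)) ⟨
    τ 𝒯 ∘ₘ (idₘ ×ₘ ιₘ)
      ∎
    where open ≈-Reasoning ((A ⊗ 𝕄 𝒮 B) ∷ []) (𝕄 𝒯 (A ⊗ B))

  ι-central : ∀ X Y → ((𝕄 𝒮 X ⊗ 𝕄 𝒯 Y) ∷ []) ⊢
                μ 𝒯 ∘ₘ (fmap 𝒯 (τ' 𝒯) ∘ₘ (τ 𝒯 ∘ₘ (ιₘ ×ₘ idₘ)))
              ≈ μ 𝒯 ∘ₘ (fmap 𝒯 (τ 𝒯) ∘ₘ (τ' 𝒯 ∘ₘ (ιₘ ×ₘ idₘ))) ∶ 𝕄 𝒯 (X ⊗ Y)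
  ι-central X Y = begin
    μ 𝒯 ∘ₘ (fmap 𝒯 (τ' 𝒯) ∘ₘ (τ 𝒯 ∘ₘ (ιₘ ×ₘ idₘ)))
      ≈⟨ central-cone-left X Y ⟩
    bind 𝒯 (snd x₀) (bind 𝒯 (iota (fst x₁)) (ret 𝒯 (pair x₀ x₁)))
      ≈⟨ central (⊢infer _) (⊢infer _) (⊢infer (ret 𝒯 (pair x₁ x₀))) ⟨
    bind 𝒯 (iota (fst x₀)) (bind 𝒯 (snd x₁) (ret 𝒯 (pair x₁ x₀)))
      ≈⟨ central-cone-right X Y ⟨
    μ 𝒯 ∘ₘ (fmap 𝒯 (τ 𝒯) ∘ₘ (τ' 𝒯 ∘ₘ (ιₘ ×ₘ idₘ)))
      ∎
    where open ≈-Reasoning ((𝕄 𝒮 X ⊗ 𝕄 𝒯 Y) ∷ []) (𝕄 𝒯 (X ⊗ Y))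

  isCentralSubmonad : IsCentralSubmonad
  isCentralSubmonad = record
    { ι-hom      = λ A → ⊢iota (⊢var zero)
    ; ι-welldef  = λ A≅A' → ≅-𝕄 𝒮 A≅A' , ≅-𝕄 𝒯 A≅A' , ≈-refl (⊢iota (⊢var zero))
    ; ι-natural  = ι-natural
    ; ι-mono     = λ _ _ → iota-inj
    ; ι-unit     = λ A → iota-ret (⊢var zero)
    ; ι-mult     = ι-mult
    ; ι-strength = ι-strength
    ; ι-central  = ι-central
    }

mainTheorem12 : (𝕋 : Theory) → CSC.IsCentralSubmonad 𝕋
mainTheorem12 = CentralSubmonad.isCentralSubmonad
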